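{- Let $\mathcal A$ be a finite alphabet with a pair of strict total orders $(<_A,<_D)$ where $<_D$ is the reverse of $<_A$, and let $L$ be a language on $\mathcal A$ satisfying the order condition for $(<_A,<_D)$. Let $a\in\mathcal A$, let $U_1,\dots,U_s$ be all the suffix (resp. prefix) return words of the letter $a$ in $L$, let $\mathcal A'=\{a_1,\dots,a_s\}$ and $\phi$ the morphism with $\phi a_i=U_i$. If $z$ is a word on $\mathcal A'$ such that $w=a\phi z$ (resp. $w=\phi z\,a$) satisfies: $F(w)$ satisfies the order condition for $(<_A,<_D)$, then $<_{Da}$ is the reverse of $<_{Aa}$ and $F(z)$ satisfies the order condition for the derived orders $(<_{Aa},<_{Da})$ with respect to $a$.
   Context: A language is a set of finite words containing the empty word, closed under factors and extendable (each $v\in L$ has letters $b,c$ with $bv, vc\in L$). $F(u)$ is the set of all factors of the word $u$. In a factor-closed set $L$, $v$ is bispecial if at least two letters $x$ have $xv\in L$ and at least two letters $y$ have $vy\in L$; a bispecial $v$ satisfies the order condition for $(<_A,<_D)$ if whenever $xvy,x'vy'\in L$ with letters $x\ne x'$, $y\neq y'$, then $x<_Ax'$ iff $y<_Dy'$; $L$ satisfies the order condition if all its bispecial words (including the empty word) do. A suffix return word of $a$ in $L$ is $v\in L$ with $av\in L$ having exactly two occurrences of $a$, one as prefix and one as suffix; a prefix return word is $v\in L$ with $va\in L$ having exactly two occurrences of $a$, as prefix and suffix. Derived orders with respect to $a$ on $\mathcal A'$: $a_i<_{Aa}a_j$ iff at the first position from the right where $a\phi a_i$ and $a\phi a_j$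 (aligned at their last letters) differ, the letter of $a\phi a_i$ is $<_A$-smaller; $a_i<_{Da}a_j$ iff at the first position from the left where $\phi a_i a$ and $\phi a_j a$ differ, the letter of $\phi a_ia$ is $<_D$-smaller. -}

module Defs where

open import Data.Nat using (ℕ)
open import Data.Fin using (Fin)
open import Data.List using (List; []; _∷_; _++_; [_]; concatMap)
open import Data.List.Membership.Propositional using (_∉_)
open import Data.Product using (Σ; ∃; _×_; _,_)
open import Relation.Binary.PropositionalEquality using (_≡_; _≢_)
open import Function.Bundles using (_⇔_)
open import Function.Definitions using (Injective)

Word : Set → Set
Word A = List A

Factor : {A : Set} → Word A → Word A → Set
Factor v u = ∃ λ p → ∃ λ s → p ++ v ++ s ≡ u

F : {A : Set} → Word A → Word A → Set
F u v = Factor v u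

record IsLanguage {A : Set} (L : Word A → Set) : Set where
  field
    has-empty    : L []
    factorClosed : ∀ u v → Factor v u → L u → L v
    extendable   : ∀ v → L v → (∃ λ b → L (b ∷ v)) × (∃ λ c → L (v ++ [ c ]))

Bispecial : {A : Set} → (Word A → Set) → Word A → Set
Bispecial L v =
  (∃ λ x → ∃ λ x' → x ≢ x' × L (x ∷ v) × L (x' ∷ v)) ×
  (∃ λ y → ∃ λ y' → y ≢ y' × L (v ++ [ y ]) × L (v ++ [ y' ]))

BispecialOrderCondition : {A : Set} → (Word A → Set) →
  (A → A → Set) → (A → A → Set) → Word A → Set
BispecialOrderCondition L _<A_ _<D_ v =
  ∀ x x' y y' → L (x ∷ v ++ [ y ]) → L (x' ∷ v ++ [ y' ]) →
  x ≢ x' → y ≢ y' → (x <A x' ⇔ y <D y')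

OrderCondition : {A : Set} → (Word A → Set) →
  (A → A → Set) → (A → A → Set) → Set
OrderCondition L _<A_ _<D_ =
  ∀ v → Bispecial L v → BispecialOrderCondition L _<A_ _<D_ v

-- suffix return word of a: v ∈ L, av ∈ L, and av has exactly two
-- occurrences of a, one as prefix and one as suffix (i.e. av = a m a, a ∉ m)
SuffixReturn : {A : Set} → (Word A → Set) → A → Word A → Set
SuffixReturn L a v = L v × L (a ∷ v) × (∃ λ m → v ≡ m ++ [ a ] × a ∉ m)

PrefixReturn : {A : Set} → (Word A → Set) → A → Word A → Set
PrefixReturn L a v = L v × L (v ++ [ a ]) × (∃ λ m → v ≡ a ∷ m × a ∉ m)

Enumerates : {A : Set} {s : ℕ} → (Word A → Set) → (Fin s → Word A) → Set
Enumerates P U = Injective _≡_ _≡_ U × (∀ i → P (U i)) × (∀ v → P v → ∃ λ i → U i ≡ v)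

φ : {A : Set} {s : ℕ} → (Fin s → Word A) → Word (Fin s) → Word A
φ U z = concatMap U z

LeftDiff : {A : Set} → (A → A → Set) → Word A → Word A → Set
LeftDiff _<_ u v = ∃ λ p → ∃ λ x → ∃ λ y → ∃ λ u' → ∃ λ v' →
  u ≡ p ++ x ∷ u' × v ≡ p ++ y ∷ v' × x < y

RightDiff : {A : Set} → (A → A → Set) → Word A → Word A → Set
RightDiff _<_ u v = ∃ λ q → ∃ λ x → ∃ λ y → ∃ λ u' → ∃ λ v' →
  u ≡ u' ++ x ∷ q × v ≡ v' ++ y ∷ q × x < y

DerivedA : {A : Set} {s : ℕ} → (A → A → Set) → A → (Fin s → Word A) → Fin s → Fin s → Set
DerivedA _<A_ a U i j = RightDiff _<A_ (a ∷ φ U (i ∷ [])) (a ∷ φ U (j ∷ []))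

DerivedD : {A : Set} {s : ℕ} → (A → A → Set) → A → (Fin s → Word A) → Fin s → Fin s → Set
DerivedD _<D_ a U i j = LeftDiff _<D_ (φ U (i ∷ []) ++ [ a ]) (φ U (j ∷ []) ++ [ a ])

{-# OPTIONS --safe #-}
module Submission where

-- Since <D reverses <A, the order condition forces the middle m of every complete return word a m a
-- (a ∉ m) to be a palindrome. Rank the n = |m| + 1 positions of the cyclic word m a by their futures (the
-- word read from the position up to the a). The positions carrying a letter c have ranks in an interval of
-- length #c, which the order condition makes the cyclic shift carry, order-preservingly, onto the mirror
-- image of that interval: the shift is a discrete symmetric interval exchange. Hence
-- rank j + rank (|m| − j) = |m| for every j, and the letters at j and |m| − 1 − j coincide.
--
-- Once the middles m_i are palindromes, both derived orders compare a_i and a_j by the first letters at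
-- which m_i a and m_j a differ, so <Da is the reverse of <Aa. An occurrence of x v y in z gives an
-- occurrence of a m_x · K · m_y a in w (K = a φv for suffix, φv a for prefix return words), and the order
-- condition of F(w) around K yields that of F(z) around v.

open import Defs
open import Data.Nat using (ℕ; zero; suc; _+_; _*_; _∸_; _≤_; _<_; z≤n; s≤s; s≤s⁻¹)
open import Data.Nat.Properties
  using (≤-refl; ≤-trans; <-≤-trans; m≤n⇒m≤1+n; m<1+n⇒m<n∨m≡n; <⇒≢; <⇒≤; suc-injective;
         +-comm; +-assoc; +-suc; *-identityʳ; *-zeroʳ; +-mono-≤; +-mono-<-≤; +-mono-≤-<;
         +-cancelʳ-≤; +-∸-assoc; n∸n≡0; ∸-cancelˡ-≡; n≤0⇒n≡0; module ≤-Reasoning)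
import Data.Nat.Properties as ℕ
open import Data.Nat.Tactic.RingSolver using (solve-∀)
open import Data.Fin using (Fin)
import Data.Fin.Properties as Fin
open import Data.List using (List; []; _∷_; _++_; [_]; reverse; length; drop; take)
open import Data.List.Properties
  using (++-assoc; ++-identityʳ; reverse-++; reverse-involutive; unfold-reverse; length-++;
         length-reverse; length-drop; take++drop≡id; concatMap-++)
open import Data.List.Membership.Propositional using (_∈_; _∉_)
open import Data.List.Membership.Propositional.Properties using (∈-++⁺ʳ)
open import Data.List.Relation.Unary.Any using (here; there)
open import Data.Product using (∃; ∃₂; _×_; _,_; proj₁; proj₂)
open import Data.Sum using (_⊎_; inj₁; inj₂)
open import Data.Empty using (⊥-elim)
open import Function using (_∘_)
open import Function.Bundles using (_⇔_; mk⇔; Equivalence)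
open import Function.Construct.Composition using (_⇔-∘_)
open import Function.Construct.Symmetry using (⇔-sym)
open import Function.Definitions using (Injective)
open import Function.Properties.Equivalence using (⇔-setoid)
open import Level using (0ℓ)
open import Relation.Nullary using (¬_; Dec; yes; no)
open import Relation.Nullary.Decidable using (map′; _⊎-dec_; _×-dec_)
open import Relation.Binary.Definitions
  using (Irreflexive; Decidable; DecidableEquality; Tri; tri<; tri≈; tri>)
open import Relation.Binary.PropositionalEquality
  using (_≡_; _≢_; refl; sym; trans; cong; cong₂; subst; subst₂; module ≡-Reasoning)
open import Relation.Binary.Structures using (IsStrictTotalOrder)
import Relation.Binary.Reasoning.Setoid as SetoidReasoning

module ⇔-Reasoning = SetoidReasoning (⇔-setoid 0ℓ)

-- First differences of words

module _ {A : Set} where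

  Diverge : List A → List A → A → A → Set
  Diverge u v x y = ∃ λ p → ∃₂ λ u′ v′ → u ≡ p ++ x ∷ u′ × v ≡ p ++ y ∷ v′ × x ≢ y

  Diverge-sym : ∀ {u v x y} → Diverge u v x y → Diverge v u y x
  Diverge-sym (p , u′ , v′ , u≡ , v≡ , x≢y) = p , v′ , u′ , v≡ , u≡ , x≢y ∘ sym

  Diverge-++ˡ : ∀ {u v x y} (α : List A) → Diverge u v x y → Diverge (α ++ u) (α ++ v) x y
  Diverge-++ˡ α (p , u′ , v′ , refl , refl , x≢y) =
    α ++ p , u′ , v′ , sym (++-assoc α p _) , sym (++-assoc α p _) , x≢y

  Diverge-++ʳ : ∀ {u v x y} (β : List A) → Diverge u v x y → Diverge (u ++ β) (v ++ β) x y
  Diverge-++ʳ β (p , u′ , v′ , refl , refl , x≢y) =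
    p , u′ ++ β , v′ ++ β , ++-assoc p (_ ∷ u′) β , ++-assoc p (_ ∷ v′) β , x≢y

  ∉-∷ʳ-diverge : DecidableEquality A → ∀ {a} m m′ → a ∉ m → a ∉ m′ → m ≢ m′ →
                 ∃₂ (Diverge (m ++ [ a ]) (m′ ++ [ a ]))
  ∉-∷ʳ-diverge _≟_ []      []       _   _    m≢m′ = ⊥-elim (m≢m′ refl)
  ∉-∷ʳ-diverge _≟_ {a} []  (y ∷ m′) _   a∉m′ _    =
    a , y , [] , [] , m′ ++ [ a ] , refl , refl , a∉m′ ∘ here
  ∉-∷ʳ-diverge _≟_ {a} (x ∷ m) []   a∉m _    _    =
    x , a , [] , m ++ [ a ] , [] , refl , refl , a∉m ∘ here ∘ sym
  ∉-∷ʳ-diverge _≟_ (x ∷ m) (y ∷ m′) a∉m a∉m′ m≢m′ with x ≟ y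
  ... | no x≢y   = x , y , [] , _ , _ , refl , refl , x≢y
  ... | yes refl with ∉-∷ʳ-diverge _≟_ m m′ (a∉m ∘ there) (a∉m′ ∘ there) (m≢m′ ∘ cong (x ∷_))
  ...   | x′ , y′ , d = x′ , y′ , Diverge-++ˡ [ x ] d

  reverse-++-∷ : ∀ (u : List A) x q → reverse (u ++ x ∷ q) ≡ reverse q ++ x ∷ reverse u
  reverse-++-∷ u x q = begin
    reverse (u ++ x ∷ q)              ≡⟨ reverse-++ u (x ∷ q) ⟩
    reverse (x ∷ q) ++ reverse u      ≡⟨ cong (_++ reverse u) (unfold-reverse x q) ⟩
    (reverse q ++ [ x ]) ++ reverse u ≡⟨ ++-assoc (reverse q) [ x ] (reverse u) ⟩
    reverse q ++ x ∷ reverse u        ∎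
    where open ≡-Reasoning

  module _ {R : A → A → Set} where

    ¬LeftDiff-[]ˡ : ∀ {v} → ¬ LeftDiff R [] v
    ¬LeftDiff-[]ˡ ([]    , _ , _ , _ , _ , () , _)
    ¬LeftDiff-[]ˡ (_ ∷ _ , _ , _ , _ , _ , () , _)

    ¬LeftDiff-[]ʳ : ∀ {u} → ¬ LeftDiff R u []
    ¬LeftDiff-[]ʳ ([]    , _ , _ , _ , _ , _ , () , _)
    ¬LeftDiff-[]ʳ (_ ∷ _ , _ , _ , _ , _ , _ , () , _)

    LeftDiff-∷⁻ : ∀ {x y u v} → LeftDiff R (x ∷ u) (y ∷ v) → R x y ⊎ (x ≡ y × LeftDiff R u v)
    LeftDiff-∷⁻ ([]    , _ , _ , _ , _ , refl , refl , r) = inj₁ r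
    LeftDiff-∷⁻ (_ ∷ p , x′ , y′ , u′ , v′ , refl , refl , r) =
      inj₂ (refl , p , x′ , y′ , u′ , v′ , refl , refl , r)

    LeftDiff-∷⁺ : ∀ {x y u v} → R x y ⊎ (x ≡ y × LeftDiff R u v) → LeftDiff R (x ∷ u) (y ∷ v)
    LeftDiff-∷⁺ {x} {y} {u} {v} (inj₁ r) = [] , x , y , u , v , refl , refl , r
    LeftDiff-∷⁺ {x} (inj₂ (refl , p , x′ , y′ , u′ , v′ , u≡ , v≡ , r)) =
      x ∷ p , x′ , y′ , u′ , v′ , cong (x ∷_) u≡ , cong (x ∷_) v≡ , r

    LeftDiff? : DecidableEquality A → Decidable R → Decidable (LeftDiff R)
    LeftDiff? _≟_ R? []      _       = no ¬LeftDiff-[]ˡ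
    LeftDiff? _≟_ R? (_ ∷ _) []      = no ¬LeftDiff-[]ʳ
    LeftDiff? _≟_ R? (x ∷ u) (y ∷ v) =
      map′ LeftDiff-∷⁺ LeftDiff-∷⁻ (R? x y ⊎-dec ((x ≟ y) ×-dec LeftDiff? _≟_ R? u v))

    module _ (irr : Irreflexive _≡_ R) where

      LeftDiff-irrefl : ∀ {u} → ¬ LeftDiff R u u
      LeftDiff-irrefl {[]}    = ¬LeftDiff-[]ˡ
      LeftDiff-irrefl {x ∷ u} d with LeftDiff-∷⁻ d
      ... | inj₁ r        = irr refl r
      ... | inj₂ (_ , d′) = LeftDiff-irrefl d′

      LeftDiff-∷-≡ : ∀ {x u v} → LeftDiff R (x ∷ u) (x ∷ v) ⇔ LeftDiff R u v
      LeftDiff-∷-≡ = mk⇔ (λ d → drop-head (LeftDiff-∷⁻ d)) (λ d → LeftDiff-∷⁺ (inj₂ (refl , d)))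
        where
        drop-head : ∀ {x u v} → R x x ⊎ (x ≡ x × LeftDiff R u v) → LeftDiff R u v
        drop-head (inj₁ r)       = ⊥-elim (irr refl r)
        drop-head (inj₂ (_ , d)) = d

      LeftDiff-∷-≢ : ∀ {x y u v} → x ≢ y → LeftDiff R (x ∷ u) (y ∷ v) ⇔ R x y
      LeftDiff-∷-≢ {x} {y} {u} {v} x≢y = mk⇔ (λ d → head (LeftDiff-∷⁻ d)) (LeftDiff-∷⁺ ∘ inj₁)
        where
        head : R x y ⊎ (x ≡ y × LeftDiff R u v) → R x y
        head (inj₁ r)         = r
        head (inj₂ (x≡y , _)) = ⊥-elim (x≢y x≡y)

      LeftDiff-diverge : ∀ {u v x y} → Diverge u v x y → LeftDiff R u v ⇔ R x y
      LeftDiff-diverge {x = x} {y} (p , u′ , v′ , refl , refl , x≢y) = after p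
        where
        after : ∀ p → LeftDiff R (p ++ x ∷ u′) (p ++ y ∷ v′) ⇔ R x y
        after []      = LeftDiff-∷-≢ x≢y
        after (_ ∷ p) = after p ⇔-∘ LeftDiff-∷-≡

    RightDiff⇔LeftDiff-reverse : ∀ {u v} → RightDiff R u v ⇔ LeftDiff R (reverse u) (reverse v)
    RightDiff⇔LeftDiff-reverse {u} {v} = mk⇔ to from
      where
      to : RightDiff R u v → LeftDiff R (reverse u) (reverse v)
      to (q , x , y , u′ , v′ , u≡ , v≡ , r) =
        reverse q , x , y , reverse u′ , reverse v′ ,
        trans (cong reverse u≡) (reverse-++-∷ u′ x q) , trans (cong reverse v≡) (reverse-++-∷ v′ y q) , r
      unreverse : ∀ {w} p z r → reverse w ≡ p ++ z ∷ r → w ≡ reverse r ++ z ∷ reverse p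
      unreverse {w} p z r eq =
        trans (sym (reverse-involutive w)) (trans (cong reverse eq) (reverse-++-∷ p z r))
      from : LeftDiff R (reverse u) (reverse v) → RightDiff R u v
      from (p , x , y , u′ , v′ , u≡ , v≡ , r) =
        reverse p , x , y , reverse u′ , reverse v′ , unreverse p x u′ u≡ , unreverse p y v′ v≡ , r

    module _ (irr : Irreflexive _≡_ R) where

      RightDiff-irrefl : ∀ {u} → ¬ RightDiff R u u
      RightDiff-irrefl = LeftDiff-irrefl irr ∘ Equivalence.to RightDiff⇔LeftDiff-reverse

      RightDiff-diverge : ∀ {u v x y} → Diverge (reverse u) (reverse v) x y → RightDiff R u v ⇔ R x y
      RightDiff-diverge d = LeftDiff-diverge irr d ⇔-∘ RightDiff⇔LeftDiff-reverse

module _ {A : Set} where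

  Factor-trans : ∀ {u v w : List A} → Factor u v → Factor v w → Factor u w
  Factor-trans {u} (p , s , refl) (p′ , s′ , refl) = p′ ++ p , s ++ s′ , (begin
    (p′ ++ p) ++ u ++ s ++ s′   ≡⟨ ++-assoc p′ p (u ++ s ++ s′) ⟩
    p′ ++ p ++ u ++ s ++ s′     ≡⟨ cong (λ t → p′ ++ p ++ t) (++-assoc u s s′) ⟨
    p′ ++ p ++ (u ++ s) ++ s′   ≡⟨ cong (p′ ++_) (++-assoc p (u ++ s) s′) ⟨
    p′ ++ (p ++ u ++ s) ++ s′   ∎)
    where open ≡-Reasoning

  FactorClosed : (Word A → Set) → Set
  FactorClosed L = ∀ u v → Factor v u → L u → L v

  F-factorClosed : (w : Word A) → FactorClosed (F w)
  F-factorClosed w _ _ = Factor-trans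

  module _ {_<A_ _<D_ : A → A → Set} {L : Word A → Set}
           (factorClosed : FactorClosed L) (oc : OrderCondition L _<A_ _<D_) where

    order-condition : ∀ {c c′ e e′ K} → L (c ∷ K ++ [ e ]) → L (c′ ∷ K ++ [ e′ ]) →
                      c ≢ c′ → e ≢ e′ → (c <A c′ ⇔ e <D e′)
    order-condition {c} {c′} {e} {e′} {K} cKe cKe′ c≢c′ e≢e′ =
      oc K bispecial c c′ e e′ cKe cKe′ c≢c′ e≢e′
      where
      init : ∀ {x y} → L (x ∷ K ++ [ y ]) → L (x ∷ K)
      init {y = y} = factorClosed _ _ ([] , [ y ] , refl)
      tail : ∀ {x y} → L (x ∷ K ++ [ y ]) → L (K ++ [ y ])
      tail {x} = factorClosed _ _ ([ x ] , [] , cong (x ∷_) (++-identityʳ _))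
      bispecial : Bispecial L K
      bispecial = (c , c′ , c≢c′ , init cKe , init cKe′) , (e , e′ , e≢e′ , tail cKe , tail cKe′)

    -- The left contexts l, l′ are read backwards from K, so c, c′ are their letters nearest to K that differ.
    order-condition-between : ∀ {l l′ K r r′ c c′ e e′} →
      L (reverse l ++ K ++ r) → L (reverse l′ ++ K ++ r′) → Diverge l l′ c c′ → Diverge r r′ e e′ →
      (c <A c′ ⇔ e <D e′)
    order-condition-between {K = K} lKr lKr′
      (p , l₁ , l₁′ , refl , refl , c≢c′) (q , r₁ , r₁′ , refl , refl , e≢e′) =
      order-condition (factorClosed _ _ (around l₁ r₁) lKr) (factorClosed _ _ (around l₁′ r₁′) lKr′)
                      c≢c′ e≢e′
      where
      around : ∀ {c e} l₁ r₁ →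
               Factor (c ∷ (reverse p ++ K ++ q) ++ [ e ]) (reverse (p ++ c ∷ l₁) ++ K ++ q ++ e ∷ r₁)
      around {c} {e} l₁ r₁ = reverse l₁ , r₁ , (begin
        reverse l₁ ++ (c ∷ (reverse p ++ K ++ q) ++ [ e ]) ++ r₁
          ≡⟨ cong (λ t → reverse l₁ ++ c ∷ t) middle ⟩
        reverse l₁ ++ c ∷ reverse p ++ K ++ q ++ e ∷ r₁
          ≡⟨ ++-assoc (reverse l₁) (c ∷ reverse p) _ ⟨
        (reverse l₁ ++ c ∷ reverse p) ++ K ++ q ++ e ∷ r₁
          ≡⟨ cong (_++ K ++ q ++ e ∷ r₁) (reverse-++-∷ p c l₁) ⟨
        reverse (p ++ c ∷ l₁) ++ K ++ q ++ e ∷ r₁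
          ∎)
        where
        open ≡-Reasoning
        middle : ((reverse p ++ K ++ q) ++ [ e ]) ++ r₁ ≡ reverse p ++ K ++ q ++ e ∷ r₁
        middle = begin
          ((reverse p ++ K ++ q) ++ [ e ]) ++ r₁ ≡⟨ ++-assoc (reverse p ++ K ++ q) [ e ] r₁ ⟩
          (reverse p ++ K ++ q) ++ e ∷ r₁        ≡⟨ ++-assoc (reverse p) (K ++ q) (e ∷ r₁) ⟩
          reverse p ++ (K ++ q) ++ e ∷ r₁        ≡⟨ cong (reverse p ++_) (++-assoc K q (e ∷ r₁)) ⟩
          reverse p ++ K ++ q ++ e ∷ r₁          ∎

∑< : ℕ → (ℕ → ℕ) → ℕ
∑< zero    f = 0
∑< (suc n) f = ∑< n f + f n

syntax ∑< n (λ l → e) = ∑[ l < n ] e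

∑-cong : ∀ n {f g : ℕ → ℕ} → (∀ l → l < n → f l ≡ g l) → ∑< n f ≡ ∑< n g
∑-cong zero    f≗g = refl
∑-cong (suc n) f≗g = cong₂ _+_ (∑-cong n (λ l l<n → f≗g l (m≤n⇒m≤1+n l<n))) (f≗g n ≤-refl)

∑-distrib-+ : ∀ n (f g : ℕ → ℕ) → ∑[ l < n ] (f l + g l) ≡ ∑< n f + ∑< n g
∑-distrib-+ zero    f g = refl
∑-distrib-+ (suc n) f g =
  trans (cong (_+ (f n + g n)) (∑-distrib-+ n f g)) (swap (∑< n f) (∑< n g) (f n) (g n))
  where
  swap : ∀ a b c d → a + b + (c + d) ≡ a + c + (b + d)
  swap = solve-∀

∑-const : ∀ n c → ∑[ _ < n ] c ≡ n * c
∑-const zero    c = refl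
∑-const (suc n) c = trans (cong (_+ c) (∑-const n c)) (+-comm (n * c) c)

∑-mono-≤ : ∀ n {f g : ℕ → ℕ} → (∀ l → l < n → f l ≤ g l) → ∑< n f ≤ ∑< n g
∑-mono-≤ zero    f≤g = z≤n
∑-mono-≤ (suc n) f≤g = +-mono-≤ (∑-mono-≤ n (λ l l<n → f≤g l (m≤n⇒m≤1+n l<n))) (f≤g n ≤-refl)

∑-mono-< : ∀ n {f g : ℕ → ℕ} {k} → k < n → (∀ l → l < n → f l ≤ g l) → f k < g k →
           ∑< n f < ∑< n g
∑-mono-< (suc n) {k = k} k<1+n f≤g fk<gk with m<1+n⇒m<n∨m≡n k<1+n
... | inj₁ k<n  = +-mono-<-≤ (∑-mono-< n k<n (λ l l<n → f≤g l (m≤n⇒m≤1+n l<n)) fk<gk) (f≤g n ≤-refl)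
... | inj₂ refl = +-mono-≤-< (∑-mono-≤ n (λ l l<n → f≤g l (m≤n⇒m≤1+n l<n))) fk<gk

∑-unfoldˡ : ∀ n (f : ℕ → ℕ) → ∑< (suc n) f ≡ f 0 + ∑[ l < n ] f (suc l)
∑-unfoldˡ zero    f = +-comm 0 (f 0)
∑-unfoldˡ (suc n) f = trans (cong (_+ f (suc n)) (∑-unfoldˡ n f)) (+-assoc (f 0) _ _)

rotate : ℕ → ℕ → ℕ
rotate M k with k ℕ.≟ M
... | yes _ = 0
... | no  _ = suc k

rotate-last : ∀ M → rotate M M ≡ 0
rotate-last M with M ℕ.≟ M
... | yes _   = refl
... | no  M≢M = ⊥-elim (M≢M refl)

rotate-≢ : ∀ {M k} → k ≢ M → rotate M k ≡ suc k
rotate-≢ {M} {k} k≢M with k ℕ.≟ M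
... | yes k≡M = ⊥-elim (k≢M k≡M)
... | no  _   = refl

rotate-< : ∀ {M k} → k < suc M → rotate M k < suc M
rotate-< {M} {k} k<1+M with m<1+n⇒m<n∨m≡n k<1+M
... | inj₁ k<M  = subst (_< suc M) (sym (rotate-≢ (<⇒≢ k<M))) (s≤s k<M)
... | inj₂ refl = subst (_< suc M) (sym (rotate-last M)) (s≤s z≤n)

rotate-injective : ∀ {M l k} → l < suc M → k < suc M → rotate M l ≡ rotate M k → l ≡ k
rotate-injective {M} l<1+M k<1+M eq with m<1+n⇒m<n∨m≡n l<1+M | m<1+n⇒m<n∨m≡n k<1+M
... | inj₁ l<M  | inj₁ k<M  =
  suc-injective (trans (sym (rotate-≢ (<⇒≢ l<M))) (trans eq (rotate-≢ (<⇒≢ k<M))))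
... | inj₁ l<M  | inj₂ refl =
  ⊥-elim (ℕ.0≢1+n (trans (sym (rotate-last M)) (trans (sym eq) (rotate-≢ (<⇒≢ l<M)))))
... | inj₂ refl | inj₁ k<M  =
  ⊥-elim (ℕ.0≢1+n (trans (sym (rotate-last M)) (trans eq (rotate-≢ (<⇒≢ k<M)))))
... | inj₂ refl | inj₂ refl = refl

∑-rotate : ∀ M (f : ℕ → ℕ) → ∑[ l < suc M ] f (rotate M l) ≡ ∑< (suc M) f
∑-rotate M f = begin
  ∑[ l < M ] f (rotate M l) + f (rotate M M)
    ≡⟨ cong₂ _+_ (∑-cong M λ l l<M → cong f (rotate-≢ (<⇒≢ l<M))) (cong f (rotate-last M)) ⟩
  ∑[ l < M ] f (suc l) + f 0                 ≡⟨ +-comm _ (f 0) ⟩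
  f 0 + ∑[ l < M ] f (suc l)                 ≡⟨ ∑-unfoldˡ M f ⟨
  ∑< (suc M) f                               ∎
  where open ≡-Reasoning

χ : {P : Set} → Dec P → ℕ
χ (yes _) = 1
χ (no  _) = 0

χ-yes : ∀ {P} (P? : Dec P) → P → χ P? ≡ 1
χ-yes (yes _) _ = refl
χ-yes (no ¬p) p = ⊥-elim (¬p p)

χ-no : ∀ {P} (P? : Dec P) → ¬ P → χ P? ≡ 0
χ-no (yes p) ¬p = ⊥-elim (¬p p)
χ-no (no  _) _  = refl

χ-mono : ∀ {P Q} → (P → Q) → (P? : Dec P) (Q? : Dec Q) → χ P? ≤ χ Q?
χ-mono _   (no _)  _       = z≤n
χ-mono _   (yes _) (yes _) = ≤-refl
χ-mono P→Q (yes p) (no ¬q) = ⊥-elim (¬q (P→Q p))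

χ-cong : ∀ {P Q} → P ⇔ Q → (P? : Dec P) (Q? : Dec Q) → χ P? ≡ χ Q?
χ-cong P⇔Q P? Q? = ℕ.≤-antisym (χ-mono (Equivalence.to P⇔Q) P? Q?) (χ-mono (Equivalence.from P⇔Q) Q? P?)

InInterval : ℕ → ℕ → ℕ → Set
InInterval lo len r = lo ≤ r × r < lo + len

InInterval-reflect : ∀ {x y M b s t} → x + y ≡ M → s + b + t ≡ suc M → InInterval t s y → InInterval b s x
InInterval-reflect {x} {y} {M} {b} {s} {t} x+y≡M total (t≤y , y<t+s) = b≤x , x<b+s
  where
  open ≤-Reasoning
  rearrange : ∀ s b t → s + b + t ≡ b + (t + s)
  rearrange = solve-∀
  b≤x : b ≤ x
  b≤x = +-cancelʳ-≤ (suc y) b x (begin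
    b + suc y     ≤⟨ ℕ.+-monoʳ-≤ b y<t+s ⟩
    b + (t + s)   ≡⟨ rearrange s b t ⟨
    s + b + t     ≡⟨ total ⟩
    suc M         ≡⟨ cong suc x+y≡M ⟨
    suc (x + y)   ≡⟨ +-suc x y ⟨
    x + suc y     ∎)
  x<b+s : x < b + s
  x<b+s = +-cancelʳ-≤ y (suc x) (b + s) (begin
    suc (x + y)   ≡⟨ cong suc x+y≡M ⟩
    suc M         ≡⟨ total ⟨
    s + b + t     ≡⟨ cong (_+ t) (+-comm s b) ⟩
    b + s + t     ≤⟨ ℕ.+-monoʳ-≤ (b + s) t≤y ⟩
    b + s + y     ∎)

at : {A : Set} → A → List A → ℕ → A
at d []       _       = d
at d (x ∷ xs) zero    = x
at d (x ∷ xs) (suc k) = at d xs k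

module _ {A : Set} (d : A) where

  at-++ˡ : ∀ (xs ys : List A) {k} → k < length xs → at d (xs ++ ys) k ≡ at d xs k
  at-++ˡ (x ∷ xs) ys {zero}  _          = refl
  at-++ˡ (x ∷ xs) ys {suc k} (s≤s k<n) = at-++ˡ xs ys k<n

  at-length : ∀ (xs : List A) y ys → at d (xs ++ y ∷ ys) (length xs) ≡ y
  at-length []       y ys = refl
  at-length (x ∷ xs) y ys = at-length xs y ys

  at-∈ : ∀ (xs : List A) {k} → k < length xs → at d xs k ∈ xs
  at-∈ (x ∷ xs) {zero}  _          = here refl
  at-∈ (x ∷ xs) {suc k} (s≤s k<n) = there (at-∈ xs k<n)

  drop-at : ∀ (xs : List A) {k} → k < length xs → drop k xs ≡ at d xs k ∷ drop (suc k) xs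
  drop-at (x ∷ xs) {zero}  _          = refl
  drop-at (x ∷ xs) {suc k} (s≤s k<n) = drop-at xs k<n

  at-reverse : ∀ (xs : List A) {j} → j < length xs → at d (reverse xs) j ≡ at d xs (length xs ∸ suc j)
  at-reverse (x ∷ xs) {j} j<1+n with m<1+n⇒m<n∨m≡n j<1+n
  ... | inj₁ j<n = begin
    at d (reverse (x ∷ xs)) j     ≡⟨ cong (λ t → at d t j) (unfold-reverse x xs) ⟩
    at d (reverse xs ++ [ x ]) j  ≡⟨ at-++ˡ (reverse xs) [ x ] (subst (j <_) (sym (length-reverse xs)) j<n) ⟩
    at d (reverse xs) j           ≡⟨ at-reverse xs j<n ⟩
    at d xs (length xs ∸ suc j)   ≡⟨ cong (at d (x ∷ xs)) (+-∸-assoc 1 j<n) ⟨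
    at d (x ∷ xs) (length xs ∸ j) ∎
    where open ≡-Reasoning
  ... | inj₂ refl = begin
    at d (reverse (x ∷ xs)) (length xs)              ≡⟨ cong (λ t → at d t (length xs)) (unfold-reverse x xs) ⟩
    at d (reverse xs ++ [ x ]) (length xs)           ≡⟨ cong (at d (reverse xs ++ [ x ])) (length-reverse xs) ⟨
    at d (reverse xs ++ [ x ]) (length (reverse xs)) ≡⟨ at-length (reverse xs) x [] ⟩
    x                                                ≡⟨ cong (at d (x ∷ xs)) (n∸n≡0 (length xs)) ⟨
    at d (x ∷ xs) (length xs ∸ length xs)            ∎
    where open ≡-Reasoning

  at-ext : ∀ (xs ys : List A) → length xs ≡ length ys → (∀ j → j < length xs → at d xs j ≡ at d ys j) →
           xs ≡ ys
  at-ext []       []       _  _   = refl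
  at-ext (x ∷ xs) (y ∷ ys) eq at≡ =
    cong₂ _∷_ (at≡ 0 (s≤s z≤n)) (at-ext xs ys (suc-injective eq) (λ j j<n → at≡ (suc j) (s≤s j<n)))

  reverse≡-from-at : ∀ (xs : List A) → (∀ j → j < length xs → at d xs j ≡ at d xs (length xs ∸ suc j)) →
                     reverse xs ≡ xs
  reverse≡-from-at xs mirror = at-ext (reverse xs) xs (length-reverse xs) λ j j<n →
    let j<n′ = subst (j <_) (length-reverse xs) j<n in trans (at-reverse xs j<n′) (sym (mirror j j<n′))

module _ {A : Set} where

  drop-++ˡ : ∀ (xs ys : List A) {k} → k ≤ length xs → drop k (xs ++ ys) ≡ drop k xs ++ ys
  drop-++ˡ xs       ys {zero}  _          = refl
  drop-++ˡ (x ∷ xs) ys {suc k} (s≤s k≤n) = drop-++ˡ xs ys k≤n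

  drop-Factor : ∀ k (xs : List A) → Factor (drop k xs) xs
  drop-Factor k xs = take k xs , [] , trans (cong (take k xs ++_) (++-identityʳ (drop k xs))) (take++drop≡id k xs)

-- Return words are palindromes

module CyclicRanks {A : Set} {_<A_ _<D_ : A → A → Set}
  (sto : IsStrictTotalOrder _≡_ _<A_) (reversed : ∀ x y → x <D y ⇔ y <A x)
  {L : Word A → Set} (factorClosed : FactorClosed L) (oc : OrderCondition L _<A_ _<D_)
  {a : A} {m : List A} (a∉m : a ∉ m) (ama∈L : L (a ∷ m ++ [ a ])) where

  open IsStrictTotalOrder sto using (compare; _≟_; irrefl) renaming (_<?_ to _<A?_; trans to <A-trans)

  M n : ℕ
  M = length m
  n = suc M

  w : List A
  w = m ++ [ a ]

  letter : ℕ → A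
  letter k = at a w k

  future : ℕ → List A
  future k = drop k w

  next : ℕ → ℕ
  next = rotate M

  letter-last : letter M ≡ a
  letter-last = at-length a m a []

  letter-≢a : ∀ {k} → k < M → letter k ≢ a
  letter-≢a k<M eq = a∉m (subst (_∈ m) (trans (sym (at-++ˡ a m [ a ] k<M)) eq) (at-∈ a m k<M))

  letter≡a⇒last : ∀ {k} → k < n → letter k ≡ a → k ≡ M
  letter≡a⇒last k<n eq with m<1+n⇒m<n∨m≡n k<n
  ... | inj₁ k<M = ⊥-elim (letter-≢a k<M eq)
  ... | inj₂ k≡M = k≡M

  same-letter⇒≢last : ∀ {l k} → k < n → l ≢ k → letter l ≡ letter k → l ≢ M
  same-letter⇒≢last k<n l≢k same refl = l≢k (sym (letter≡a⇒last k<n (trans (sym same) letter-last)))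

  future-∷ : ∀ {k} → k < n → future k ≡ letter k ∷ future (suc k)
  future-∷ k<n = drop-at a w (subst (_ <_) (sym (trans (length-++ m) (+-comm M 1))) k<n)

  future-next∈L : ∀ {k} → k < n → L (letter k ∷ future (next k))
  future-next∈L {k} k<n with m<1+n⇒m<n∨m≡n k<n
  ... | inj₂ refl = subst₂ (λ c t → L (c ∷ t)) (sym letter-last) (cong future (sym (rotate-last M))) ama∈L
  ... | inj₁ k<M  = subst (λ t → L (letter k ∷ t)) (cong future (sym (rotate-≢ (<⇒≢ k<M))))
                      (subst L (future-∷ k<n) (factorClosed _ _ (drop-Factor (suc k) (a ∷ w)) ama∈L))

  futures-diverge : ∀ {l k} → l < n → k < n → l ≢ k → ∃₂ (Diverge (future l) (future k))
  futures-diverge {l} {k} l<n k<n l≢k =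
    subst₂ (λ u v → ∃₂ (Diverge u v))
           (sym (drop-++ˡ m [ a ] (s≤s⁻¹ l<n))) (sym (drop-++ˡ m [ a ] (s≤s⁻¹ k<n)))
      (∉-∷ʳ-diverge _≟_ (drop l m) (drop k m) (a∉drop l) (a∉drop k) (l≢k ∘ drop-injective))
    where
    a∉drop : ∀ j → a ∉ drop j m
    a∉drop j a∈ = a∉m (subst (a ∈_) (take++drop≡id j m) (∈-++⁺ʳ (take j m) a∈))
    drop-injective : drop l m ≡ drop k m → l ≡ k
    drop-injective eq = ∸-cancelˡ-≡ (s≤s⁻¹ l<n) (s≤s⁻¹ k<n)
      (trans (sym (length-drop l m)) (trans (cong length eq) (length-drop k m)))

  _≺_ : ℕ → ℕ → Set
  l ≺ k = LeftDiff _<A_ (future l) (future k)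

  _≺?_ : Decidable _≺_
  l ≺? k = LeftDiff? _≟_ _<A?_ (future l) (future k)

  ≺-irrefl : ∀ {k} → ¬ k ≺ k
  ≺-irrefl = LeftDiff-irrefl irrefl

  ≺-letter : ∀ {l k} → l < n → k < n → letter l ≢ letter k → (l ≺ k ⇔ letter l <A letter k)
  ≺-letter {l} {k} l<n k<n ≢ =
    subst₂ (λ u v → LeftDiff _<A_ u v ⇔ letter l <A letter k) (sym (future-∷ l<n)) (sym (future-∷ k<n))
           (LeftDiff-∷-≢ irrefl ≢)

  ≺-next-same-letter : ∀ {l k} → l < n → k < n → l ≢ k → letter l ≡ letter k →
                       (next l ≺ next k ⇔ l ≺ k)
  ≺-next-same-letter {l} {k} l<n k<n l≢k same
    rewrite rotate-≢ (same-letter⇒≢last k<n l≢k same)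
          | rotate-≢ (same-letter⇒≢last l<n (l≢k ∘ sym) (sym same))
          | future-∷ l<n | future-∷ k<n | same
    = ⇔-sym (LeftDiff-∷-≡ irrefl)

  -- The only use of the order condition: after distinct letters, futures are ordered in reverse.
  ≺-next-letter : ∀ {l k} → l < n → k < n → l ≢ k → letter l ≢ letter k →
                  (next l ≺ next k ⇔ letter k <A letter l)
  ≺-next-letter {l} {k} l<n k<n l≢k ≢
    with futures-diverge (rotate-< l<n) (rotate-< k<n) (l≢k ∘ rotate-injective l<n k<n)
  ... | y , y′ , d = begin
    next l ≺ next k      ≈⟨ LeftDiff-diverge irrefl d ⟩
    y <A y′              ≈⟨ reversed y′ y ⟨
    y′ <D y              ≈⟨ order-condition-between factorClosed oc {l = [ letter k ]} {l′ = [ letter l ]} {K = []}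
                              (future-next∈L k<n) (future-next∈L l<n) letters (Diverge-sym d) ⟨
    letter k <A letter l ∎
    where
    open ⇔-Reasoning
    letters : Diverge [ letter k ] [ letter l ] (letter k) (letter l)
    letters = [] , [] , [] , refl , refl , ≢ ∘ sym

  rank classRank : ℕ → ℕ
  rank k      = ∑[ l < n ] χ (l ≺? k)
  classRank k = ∑[ l < n ] χ ((letter l ≟ letter k) ×-dec (l ≺? k))

  count below above : A → ℕ
  count c = ∑[ l < n ] χ (letter l ≟ c)
  below c = ∑[ l < n ] χ (letter l <A? c)
  above c = ∑[ l < n ] χ (c <A? letter l)

  rank≡ : ∀ {k} → k < n → rank k ≡ classRank k + below (letter k)
  rank≡ {k} k<n = trans (∑-cong n (λ l l<n → by-letter l<n (letter l ≟ letter k))) (∑-distrib-+ n _ _)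
    where
    by-letter : ∀ {l} → l < n → Dec (letter l ≡ letter k) →
                χ (l ≺? k) ≡ χ ((letter l ≟ letter k) ×-dec (l ≺? k)) + χ (letter l <A? letter k)
    by-letter {l} l<n (yes same) rewrite χ-no (letter l <A? letter k) (irrefl same) =
      trans (χ-cong (mk⇔ (same ,_) proj₂) (l ≺? k) _) (sym (ℕ.+-identityʳ _))
    by-letter {l} l<n (no ≢) rewrite χ-no ((letter l ≟ letter k) ×-dec (l ≺? k)) (≢ ∘ proj₁) =
      χ-cong (≺-letter l<n k<n ≢) (l ≺? k) (letter l <A? letter k)

  rank-next≡ : ∀ {k} → k < n → rank (next k) ≡ classRank k + above (letter k)
  rank-next≡ {k} k<n = begin
    rank (next k)                   ≡⟨ ∑-rotate M (λ l → χ (l ≺? next k)) ⟨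
    ∑[ l < n ] χ (next l ≺? next k) ≡⟨ ∑-cong n (λ l l<n → by-position l<n (l ℕ.≟ k)) ⟩
    ∑[ l < n ] (χ ((letter l ≟ letter k) ×-dec (l ≺? k)) + χ (letter k <A? letter l))
                                    ≡⟨ ∑-distrib-+ n _ _ ⟩
    classRank k + above (letter k)  ∎
    where
    open ≡-Reasoning
    by-letter : ∀ {l} → l < n → l ≢ k → Dec (letter l ≡ letter k) →
                χ (next l ≺? next k) ≡ χ ((letter l ≟ letter k) ×-dec (l ≺? k)) + χ (letter k <A? letter l)
    by-letter {l} l<n l≢k (yes same) rewrite χ-no (letter k <A? letter l) (irrefl (sym same)) =
      trans (χ-cong (mk⇔ (λ p → same , to p) (from ∘ proj₂)) (next l ≺? next k) _) (sym (ℕ.+-identityʳ _))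
      where open Equivalence (≺-next-same-letter l<n k<n l≢k same)
    by-letter {l} l<n l≢k (no ≢) rewrite χ-no ((letter l ≟ letter k) ×-dec (l ≺? k)) (≢ ∘ proj₁) =
      χ-cong (≺-next-letter l<n k<n l≢k ≢) (next l ≺? next k) (letter k <A? letter l)
    by-position : ∀ {l} → l < n → Dec (l ≡ k) →
                  χ (next l ≺? next k) ≡ χ ((letter l ≟ letter k) ×-dec (l ≺? k)) + χ (letter k <A? letter l)
    by-position {l} l<n (no l≢k) = by-letter l<n l≢k (letter l ≟ letter k)
    by-position {l} l<n (yes refl)
      rewrite χ-no (next l ≺? next l) (≺-irrefl {next l})
            | χ-no ((letter l ≟ letter l) ×-dec (l ≺? l)) (≺-irrefl {l} ∘ proj₂)
            | χ-no (letter l <A? letter l) (irrefl refl) = refl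

  count+below+above : ∀ c → count c + below c + above c ≡ n
  count+below+above c = begin
    count c + below c + above c                  ≡⟨ cong (_+ above c) (∑-distrib-+ n _ _) ⟨
    ∑[ l < n ] (χ (letter l ≟ c) + χ (letter l <A? c)) + above c
                                                 ≡⟨ ∑-distrib-+ n _ _ ⟨
    ∑[ l < n ] (χ (letter l ≟ c) + χ (letter l <A? c) + χ (c <A? letter l))
                                                 ≡⟨ ∑-cong n (λ l _ → trichotomy (compare (letter l) c)) ⟩
    ∑[ _ < n ] 1                                 ≡⟨ ∑-const n 1 ⟩
    n * 1                                        ≡⟨ *-identityʳ n ⟩
    n                                            ∎
    where
    open ≡-Reasoning
    trichotomy : ∀ {x} → Tri (x <A c) (x ≡ c) (c <A x) → χ (x ≟ c) + χ (x <A? c) + χ (c <A? x) ≡ 1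
    trichotomy {x} (tri< x<c x≢c c≮x)
      rewrite χ-no (x ≟ c) x≢c | χ-yes (x <A? c) x<c | χ-no (c <A? x) c≮x = refl
    trichotomy {x} (tri≈ x≮c x≡c c≮x)
      rewrite χ-yes (x ≟ c) x≡c | χ-no (x <A? c) x≮c | χ-no (c <A? x) c≮x = refl
    trichotomy {x} (tri> x≮c x≢c c<x)
      rewrite χ-no (x ≟ c) x≢c | χ-no (x <A? c) x≮c | χ-yes (c <A? x) c<x = refl

  classRank<count : ∀ {k} → k < n → classRank k < count (letter k)
  classRank<count {k} k<n = ∑-mono-< n k<n (λ l _ → χ-mono proj₁ _ _) at-k
    where
    at-k : χ ((letter k ≟ letter k) ×-dec (k ≺? k)) < χ (letter k ≟ letter k)
    at-k rewrite χ-no ((letter k ≟ letter k) ×-dec (k ≺? k)) (≺-irrefl {k} ∘ proj₂)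
               | χ-yes (letter k ≟ letter k) refl = s≤s z≤n

  below+count≤below : ∀ {c d} → c <A d → below c + count c ≤ below d
  below+count≤below {c} {d} c<d =
    subst (_≤ below d) (∑-distrib-+ n _ _) (∑-mono-≤ n (λ l _ → pointwise (compare (letter l) c)))
    where
    pointwise : ∀ {x} → Tri (x <A c) (x ≡ c) (c <A x) → χ (x <A? c) + χ (x ≟ c) ≤ χ (x <A? d)
    pointwise {x} (tri< x<c x≢c _)
      rewrite χ-yes (x <A? c) x<c | χ-no (x ≟ c) x≢c | χ-yes (x <A? d) (<A-trans x<c c<d) = ≤-refl
    pointwise {x} (tri≈ x≮c refl _)
      rewrite χ-no (x <A? c) x≮c | χ-yes (x ≟ x) refl | χ-yes (x <A? d) c<d = ≤-refl
    pointwise {x} (tri> x≮c x≢c _)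
      rewrite χ-no (x <A? c) x≮c | χ-no (x ≟ c) x≢c = z≤n

  count-a : count a ≡ 1
  count-a = cong₂ _+_
    (trans (∑-cong M λ l l<M → χ-no (letter l ≟ a) (letter-≢a l<M)) (trans (∑-const M 0) (*-zeroʳ M)))
    (χ-yes (letter M ≟ a) letter-last)

  rank-interval : ∀ {k} → k < n → InInterval (below (letter k)) (count (letter k)) (rank k)
  rank-interval {k} k<n rewrite rank≡ k<n =
    ℕ.m≤n+m (below c) (classRank k) ,
    subst (classRank k + below c <_) (+-comm (count c) (below c)) (ℕ.+-monoˡ-< (below c) (classRank<count k<n))
    where c = letter k

  rank-next-interval : ∀ {k} → k < n → InInterval (above (letter k)) (count (letter k)) (rank (next k))
  rank-next-interval {k} k<n rewrite rank-next≡ k<n =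
    ℕ.m≤n+m (above c) (classRank k) ,
    subst (classRank k + above c <_) (+-comm (count c) (above c)) (ℕ.+-monoˡ-< (above c) (classRank<count k<n))
    where c = letter k

  rank-interval-unique : ∀ {r c d} → InInterval (below c) (count c) r → InInterval (below d) (count d) r → c ≡ d
  rank-interval-unique {r} {c} {d} (c≤r , r<c) (d≤r , r<d) with compare c d
  ... | tri< c<d _ _ = ⊥-elim (ℕ.<-irrefl refl (<-≤-trans r<c (≤-trans (below+count≤below c<d) d≤r)))
  ... | tri≈ _ c≡d _ = c≡d
  ... | tri> _ _ d<c = ⊥-elim (ℕ.<-irrefl refl (<-≤-trans r<d (≤-trans (below+count≤below d<c) c≤r)))

  mirrored-letters : ∀ {j k} → j < n → k < n → rank j + rank (next k) ≡ M → letter j ≡ letter k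
  mirrored-letters j<n k<n sum = rank-interval-unique (rank-interval j<n)
    (InInterval-reflect sum (count+below+above _) (rank-next-interval k<n))

  mirror-last : rank 0 + rank M ≡ M
  mirror-last = begin
    rank 0 + rank M                     ≡⟨ cong₂ _+_ rank-0 (rank≡ ≤-refl) ⟩
    classRank M + above (letter M) + (classRank M + below (letter M))
      ≡⟨ cong (λ r → r + above (letter M) + (r + below (letter M))) classRank-last ⟩
    above (letter M) + below (letter M) ≡⟨ cong (λ c → above c + below c) letter-last ⟩
    above a + below a                   ≡⟨ +-comm (above a) (below a) ⟩
    below a + above a
      ≡⟨ suc-injective (trans (cong (λ c → c + below a + above a) (sym count-a)) (count+below+above a)) ⟩
    M                                   ∎
    where
    open ≡-Reasoning
    rank-0 : rank 0 ≡ classRank M + above (letter M)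
    rank-0 = trans (cong rank (sym (rotate-last M))) (rank-next≡ ≤-refl)
    classRank-last : classRank M ≡ 0
    classRank-last = n≤0⇒n≡0 (s≤s⁻¹ (subst (classRank M <_) count-last (classRank<count ≤-refl)))
      where count-last = trans (cong count letter-last) count-a

  mirror-step : ∀ {j} → j < M → rank j + rank (M ∸ j) ≡ M →
                letter j ≡ letter (M ∸ suc j) × rank (suc j) + rank (M ∸ suc j) ≡ M
  mirror-step {j} j<M sum = same , (begin
    rank (suc j) + rank k  ≡⟨ cong (λ i → rank i + rank k) next-j ⟨
    rank (next j) + rank k ≡⟨ cong₂ _+_ (rank-next≡ j<n) (rank≡ k<n) ⟩
    classRank j + above (letter j) + (classRank k + below (letter k))
      ≡⟨ cong₂ (λ c d → classRank j + above c + (classRank k + below d)) same (sym same) ⟩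
    classRank j + above (letter k) + (classRank k + below (letter j))
      ≡⟨ swap (classRank j) (above (letter k)) (classRank k) (below (letter j)) ⟩
    classRank j + below (letter j) + (classRank k + above (letter k))
      ≡⟨ cong₂ _+_ (rank≡ j<n) (rank-next≡ k<n) ⟨
    rank j + rank (next k) ≡⟨ cong (λ i → rank j + rank i) next-k ⟩
    rank j + rank (M ∸ j)  ≡⟨ sum ⟩
    M                      ∎)
    where
    open ≡-Reasoning
    k = M ∸ suc j
    j<n : j < n
    j<n = m≤n⇒m≤1+n j<M
    k<M : k < M
    k<M = ℕ.∸-monoʳ-< (s≤s z≤n) j<M
    k<n : k < n
    k<n = m≤n⇒m≤1+n k<M
    next-j : next j ≡ suc j
    next-j = rotate-≢ (<⇒≢ j<M)
    next-k : next k ≡ M ∸ j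
    next-k = trans (rotate-≢ (<⇒≢ k<M)) (sym (+-∸-assoc 1 j<M))
    same : letter j ≡ letter k
    same = mirrored-letters j<n k<n (trans (cong (λ i → rank j + rank i) next-k) sum)
    swap : ∀ a b c d → a + b + (c + d) ≡ a + d + (c + b)
    swap = solve-∀

  mirror : ∀ {j} → j ≤ M → rank j + rank (M ∸ j) ≡ M
  mirror {zero}  _   = mirror-last
  mirror {suc j} j<M = proj₂ (mirror-step j<M (mirror (<⇒≤ j<M)))

  palindrome : reverse m ≡ m
  palindrome = reverse≡-from-at a m λ j j<M → begin
    at a m j           ≡⟨ at-++ˡ a m [ a ] j<M ⟨
    letter j           ≡⟨ proj₁ (mirror-step j<M (mirror (<⇒≤ j<M))) ⟩
    letter (M ∸ suc j) ≡⟨ at-++ˡ a m [ a ] (ℕ.∸-monoʳ-< (s≤s z≤n) j<M) ⟩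
    at a m (M ∸ suc j) ∎
    where open ≡-Reasoning

return-word-palindrome : ∀ {A : Set} {_<A_ _<D_ : A → A → Set} → IsStrictTotalOrder _≡_ _<A_ →
  (∀ x y → x <D y ⇔ y <A x) → ∀ {L} → FactorClosed L → OrderCondition L _<A_ _<D_ →
  ∀ {a m} → a ∉ m → L (a ∷ m ++ [ a ]) → reverse m ≡ m
return-word-palindrome = CyclicRanks.palindrome

-- Derived orders

module _ {A : Set} {s : ℕ} (U : Fin s → List A) where

  φ-singleton : ∀ i → φ U [ i ] ≡ U i
  φ-singleton i = ++-identityʳ (U i)

  φ-∷-∷ʳ : ∀ x v y → φ U (x ∷ v ++ [ y ]) ≡ U x ++ φ U v ++ U y
  φ-∷-∷ʳ x v y = cong (U x ++_) (trans (concatMap-++ U v [ y ]) (cong (φ U v ++_) (φ-singleton y)))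

  φ-factor : ∀ p u q → φ U (p ++ u ++ q) ≡ φ U p ++ φ U u ++ φ U q
  φ-factor p u q = trans (concatMap-++ U p (u ++ q)) (cong (φ U p ++_) (concatMap-++ U u q))

  module _ {a : A} where

    a∷φ-ends-with : (∀ i → ∃ λ t → U i ≡ t ++ [ a ]) → ∀ p → ∃ λ q → a ∷ φ U p ≡ q ++ [ a ]
    a∷φ-ends-with ends []      = [] , refl
    a∷φ-ends-with ends (i ∷ p) with ends i | a∷φ-ends-with ends p
    ... | t , U≡ | q , a∷φ≡ = a ∷ t ++ q , (begin
      a ∷ U i ++ φ U p          ≡⟨ cong (λ r → a ∷ r ++ φ U p) U≡ ⟩
      a ∷ (t ++ [ a ]) ++ φ U p ≡⟨ cong (a ∷_) (++-assoc t [ a ] (φ U p)) ⟩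
      a ∷ t ++ a ∷ φ U p        ≡⟨ cong (λ r → a ∷ t ++ r) a∷φ≡ ⟩
      a ∷ t ++ q ++ [ a ]       ≡⟨ cong (a ∷_) (++-assoc t q [ a ]) ⟨
      a ∷ (t ++ q) ++ [ a ]     ∎)
      where open ≡-Reasoning

    a∷φ-Factor : (∀ i → ∃ λ t → U i ≡ t ++ [ a ]) → ∀ {u z} → Factor u z →
                 Factor (a ∷ φ U u) (a ∷ φ U z)
    a∷φ-Factor ends {u} (p , q , refl) with a∷φ-ends-with ends p
    ... | r , a∷φ≡ = r , φ U q , (begin
      r ++ (a ∷ φ U u) ++ φ U q      ≡⟨ ++-assoc r [ a ] (φ U u ++ φ U q) ⟨
      (r ++ [ a ]) ++ φ U u ++ φ U q ≡⟨ cong (_++ φ U u ++ φ U q) a∷φ≡ ⟨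
      a ∷ φ U p ++ φ U u ++ φ U q    ≡⟨ cong (a ∷_) (φ-factor p u q) ⟨
      a ∷ φ U (p ++ u ++ q)          ∎)
      where open ≡-Reasoning

    φ∷ʳ-starts-with : (∀ i → ∃ λ t → U i ≡ a ∷ t) → ∀ q → ∃ λ t → φ U q ++ [ a ] ≡ a ∷ t
    φ∷ʳ-starts-with starts []      = [] , refl
    φ∷ʳ-starts-with starts (i ∷ q) with starts i
    ... | t , U≡ = (t ++ φ U q) ++ [ a ] , cong (λ r → (r ++ φ U q) ++ [ a ]) U≡

    φ∷ʳ-Factor : (∀ i → ∃ λ t → U i ≡ a ∷ t) → ∀ {u z} → Factor u z →
                 Factor (φ U u ++ [ a ]) (φ U z ++ [ a ])
    φ∷ʳ-Factor starts {u} (p , q , refl) with φ∷ʳ-starts-with starts q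
    ... | t , φ∷ʳ≡ = φ U p , t , (begin
      φ U p ++ (φ U u ++ [ a ]) ++ t     ≡⟨ cong (φ U p ++_) (++-assoc (φ U u) [ a ] t) ⟩
      φ U p ++ φ U u ++ a ∷ t            ≡⟨ cong (λ r → φ U p ++ φ U u ++ r) φ∷ʳ≡ ⟨
      φ U p ++ φ U u ++ φ U q ++ [ a ]   ≡⟨ cong (φ U p ++_) (++-assoc (φ U u) (φ U q) [ a ]) ⟨
      φ U p ++ (φ U u ++ φ U q) ++ [ a ] ≡⟨ ++-assoc (φ U p) (φ U u ++ φ U q) [ a ] ⟨
      (φ U p ++ φ U u ++ φ U q) ++ [ a ] ≡⟨ cong (_++ [ a ]) (φ-factor p u q) ⟨
      φ U (p ++ u ++ q) ++ [ a ]         ∎)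
      where open ≡-Reasoning

reverse-∷ʳ-palindrome : ∀ {A : Set} {a : A} {m} → reverse m ≡ m → reverse (m ++ [ a ]) ≡ a ∷ m
reverse-∷ʳ-palindrome {a = a} {m} palindromic = trans (reverse-++ m [ a ]) (cong (a ∷_) palindromic)

module SuffixReturnWords {A : Set} {_<A_ _<D_ : A → A → Set}
  (irrA : Irreflexive _≡_ _<A_) (irrD : Irreflexive _≡_ _<D_)
  {a : A} {s : ℕ} (U middle : Fin s → List A) (U≡ : ∀ i → U i ≡ middle i ++ [ a ])
  (palindromic : ∀ i → reverse (middle i) ≡ middle i) where

  DerivedD-diverge : ∀ {i j x y} → Diverge (middle i ++ [ a ]) (middle j ++ [ a ]) x y →
                     DerivedD _<D_ a U i j ⇔ x <D y
  DerivedD-diverge {i} {j} d =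
    LeftDiff-diverge irrD (subst₂ (λ u v → Diverge u v _ _) (sym (frame i)) (sym (frame j)) (Diverge-++ʳ [ a ] d))
    where
    frame : ∀ i → φ U [ i ] ++ [ a ] ≡ (middle i ++ [ a ]) ++ [ a ]
    frame i = cong (_++ [ a ]) (trans (φ-singleton U i) (U≡ i))

  DerivedA-diverge : ∀ {i j x y} → Diverge (middle i ++ [ a ]) (middle j ++ [ a ]) x y →
                     DerivedA _<A_ a U i j ⇔ x <A y
  DerivedA-diverge {i} {j} d =
    RightDiff-diverge irrA (subst₂ (λ u v → Diverge u v _ _) (sym (frame i)) (sym (frame j)) (Diverge-++ˡ [ a ] d))
    where
    frame : ∀ i → reverse (a ∷ φ U [ i ]) ≡ a ∷ middle i ++ [ a ]
    frame i = begin
      reverse (a ∷ φ U [ i ])              ≡⟨ cong (reverse ∘ (a ∷_)) (trans (φ-singleton U i) (U≡ i)) ⟩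
      reverse (a ∷ middle i ++ [ a ])      ≡⟨ unfold-reverse a (middle i ++ [ a ]) ⟩
      reverse (middle i ++ [ a ]) ++ [ a ] ≡⟨ cong (_++ [ a ]) (reverse-∷ʳ-palindrome (palindromic i)) ⟩
      a ∷ middle i ++ [ a ]                ∎
      where open ≡-Reasoning

  occurrence : ∀ {z x v y} → F z (x ∷ v ++ [ y ]) →
               F (a ∷ φ U z) (reverse (middle x ++ [ a ]) ++ (a ∷ φ U v) ++ middle y ++ [ a ])
  occurrence {x = x} {v} {y} xvy = subst (F _) image (a∷φ-Factor U (λ i → middle i , U≡ i) xvy)
    where
    open ≡-Reasoning
    image : a ∷ φ U (x ∷ v ++ [ y ]) ≡ reverse (middle x ++ [ a ]) ++ (a ∷ φ U v) ++ middle y ++ [ a ]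
    image = begin
      a ∷ φ U (x ∷ v ++ [ y ])                              ≡⟨ cong (a ∷_) (φ-∷-∷ʳ U x v y) ⟩
      a ∷ U x ++ φ U v ++ U y                               ≡⟨ cong₂ (λ p q → a ∷ p ++ φ U v ++ q) (U≡ x) (U≡ y) ⟩
      a ∷ (middle x ++ [ a ]) ++ φ U v ++ middle y ++ [ a ] ≡⟨ cong (a ∷_) (++-assoc (middle x) [ a ] _) ⟩
      a ∷ middle x ++ a ∷ φ U v ++ middle y ++ [ a ]
        ≡⟨ cong (_++ a ∷ φ U v ++ middle y ++ [ a ]) (reverse-∷ʳ-palindrome (palindromic x)) ⟨
      reverse (middle x ++ [ a ]) ++ (a ∷ φ U v) ++ middle y ++ [ a ] ∎

module PrefixReturnWords {A : Set} {_<A_ _<D_ : A → A → Set}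
  (irrA : Irreflexive _≡_ _<A_) (irrD : Irreflexive _≡_ _<D_)
  {a : A} {s : ℕ} (U middle : Fin s → List A) (U≡ : ∀ i → U i ≡ a ∷ middle i)
  (palindromic : ∀ i → reverse (middle i) ≡ middle i) where

  DerivedD-diverge : ∀ {i j x y} → Diverge (middle i ++ [ a ]) (middle j ++ [ a ]) x y →
                     DerivedD _<D_ a U i j ⇔ x <D y
  DerivedD-diverge {i} {j} d =
    LeftDiff-diverge irrD (subst₂ (λ u v → Diverge u v _ _) (sym (frame i)) (sym (frame j)) (Diverge-++ˡ [ a ] d))
    where
    frame : ∀ i → φ U [ i ] ++ [ a ] ≡ a ∷ middle i ++ [ a ]
    frame i = cong (_++ [ a ]) (trans (φ-singleton U i) (U≡ i))

  DerivedA-diverge : ∀ {i j x y} → Diverge (middle i ++ [ a ]) (middle j ++ [ a ]) x y →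
                     DerivedA _<A_ a U i j ⇔ x <A y
  DerivedA-diverge {i} {j} d =
    RightDiff-diverge irrA (subst₂ (λ u v → Diverge u v _ _) (sym (frame i)) (sym (frame j)) (Diverge-++ʳ [ a ] d))
    where
    frame : ∀ i → reverse (a ∷ φ U [ i ]) ≡ (middle i ++ [ a ]) ++ [ a ]
    frame i = begin
      reverse (a ∷ φ U [ i ])                ≡⟨ cong (reverse ∘ (a ∷_)) (trans (φ-singleton U i) (U≡ i)) ⟩
      reverse (a ∷ a ∷ middle i)             ≡⟨ unfold-reverse a (a ∷ middle i) ⟩
      reverse (a ∷ middle i) ++ [ a ]        ≡⟨ cong (_++ [ a ]) (unfold-reverse a (middle i)) ⟩
      (reverse (middle i) ++ [ a ]) ++ [ a ] ≡⟨ cong (λ m → (m ++ [ a ]) ++ [ a ]) (palindromic i) ⟩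
      (middle i ++ [ a ]) ++ [ a ]           ∎
      where open ≡-Reasoning

  occurrence : ∀ {z x v y} → F z (x ∷ v ++ [ y ]) →
               F (φ U z ++ [ a ]) (reverse (middle x ++ [ a ]) ++ (φ U v ++ [ a ]) ++ middle y ++ [ a ])
  occurrence {x = x} {v} {y} xvy = subst (F _) image (φ∷ʳ-Factor U (λ i → middle i , U≡ i) xvy)
    where
    open ≡-Reasoning
    image : φ U (x ∷ v ++ [ y ]) ++ [ a ] ≡ reverse (middle x ++ [ a ]) ++ (φ U v ++ [ a ]) ++ middle y ++ [ a ]
    image = begin
      φ U (x ∷ v ++ [ y ]) ++ [ a ]                  ≡⟨ cong (_++ [ a ]) (φ-∷-∷ʳ U x v y) ⟩
      (U x ++ φ U v ++ U y) ++ [ a ]                 ≡⟨ ++-assoc (U x) (φ U v ++ U y) [ a ] ⟩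
      U x ++ (φ U v ++ U y) ++ [ a ]                 ≡⟨ cong (U x ++_) (++-assoc (φ U v) (U y) [ a ]) ⟩
      U x ++ φ U v ++ U y ++ [ a ]                   ≡⟨ cong₂ (λ p q → p ++ φ U v ++ q ++ [ a ]) (U≡ x) (U≡ y) ⟩
      a ∷ middle x ++ φ U v ++ a ∷ middle y ++ [ a ] ≡⟨ cong (λ r → a ∷ middle x ++ r) (++-assoc (φ U v) [ a ] _) ⟨
      a ∷ middle x ++ (φ U v ++ [ a ]) ++ middle y ++ [ a ]
        ≡⟨ cong (_++ (φ U v ++ [ a ]) ++ middle y ++ [ a ]) (reverse-∷ʳ-palindrome (palindromic x)) ⟨
      reverse (middle x ++ [ a ]) ++ (φ U v ++ [ a ]) ++ middle y ++ [ a ] ∎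

module DerivedOrders {A : Set} {_<A_ _<D_ : A → A → Set} (_≟_ : DecidableEquality A)
  (irrA : Irreflexive _≡_ _<A_) (irrD : Irreflexive _≡_ _<D_)
  {a : A} {s : ℕ} (U middle : Fin s → List A)
  (a∉middle : ∀ i → a ∉ middle i) (middle-injective : Injective _≡_ _≡_ middle)
  (DerivedD-diverge : ∀ {i j x y} → Diverge (middle i ++ [ a ]) (middle j ++ [ a ]) x y →
                      DerivedD _<D_ a U i j ⇔ x <D y)
  (DerivedA-diverge : ∀ {i j x y} → Diverge (middle i ++ [ a ]) (middle j ++ [ a ]) x y →
                      DerivedA _<A_ a U i j ⇔ x <A y)
  where

  open ⇔-Reasoning

  middles-diverge : ∀ {i j} → i ≢ j → ∃₂ (Diverge (middle i ++ [ a ]) (middle j ++ [ a ]))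
  middles-diverge {i} {j} i≢j =
    ∉-∷ʳ-diverge _≟_ (middle i) (middle j) (a∉middle i) (a∉middle j) (i≢j ∘ middle-injective)

  derived-orders-reversed : (∀ x y → x <D y ⇔ y <A x) → ∀ i j → DerivedD _<D_ a U i j ⇔ DerivedA _<A_ a U j i
  derived-orders-reversed reversed i j with i Fin.≟ j
  ... | yes refl = mk⇔ (⊥-elim ∘ LeftDiff-irrefl irrD) (⊥-elim ∘ RightDiff-irrefl irrA)
  ... | no i≢j with middles-diverge i≢j
  ...   | x , y , d = begin
    DerivedD _<D_ a U i j ≈⟨ DerivedD-diverge d ⟩
    x <D y                ≈⟨ reversed x y ⟩
    y <A x                ≈⟨ DerivedA-diverge (Diverge-sym d) ⟨
    DerivedA _<A_ a U j i ∎

  derived-order-condition : ∀ {z w} (K : List (Fin s) → List A) →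
    (∀ {x v y} → F z (x ∷ v ++ [ y ]) → F w (reverse (middle x ++ [ a ]) ++ K v ++ middle y ++ [ a ])) →
    OrderCondition (F w) _<A_ _<D_ → OrderCondition (F z) (DerivedA _<A_ a U) (DerivedD _<D_ a U)
  derived-order-condition {w = w} K occurrence ocw v _ x x′ y y′ xvy x′vy′ x≢x′ y≢y′
    with middles-diverge x≢x′ | middles-diverge y≢y′
  ... | c , c′ , dx | e , e′ , dy = begin
    DerivedA _<A_ a U x x′ ≈⟨ DerivedA-diverge dx ⟩
    c <A c′                ≈⟨ order-condition-between (F-factorClosed w) ocw {K = K v}
                                (occurrence xvy) (occurrence x′vy′) dx dy ⟩
    e <D e′                ≈⟨ DerivedD-diverge dy ⟨
    DerivedD _<D_ a U y y′ ∎

module _ {A : Set} {_<A_ _<D_ : A → A → Set}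
  (stoA : IsStrictTotalOrder _≡_ _<A_) (stoD : IsStrictTotalOrder _≡_ _<D_) (reversed : ∀ x y → x <D y ⇔ y <A x)
  {L : Word A → Set} (isL : IsLanguage L) (ocL : OrderCondition L _<A_ _<D_) (a : A) where

  open IsStrictTotalOrder stoA using (_≟_) renaming (irrefl to irrA)
  open IsStrictTotalOrder stoD using () renaming (irrefl to irrD)

  private
    palindromic : ∀ {m} → a ∉ m → L (a ∷ m ++ [ a ]) → reverse m ≡ m
    palindromic = return-word-palindrome stoA reversed (IsLanguage.factorClosed isL) ocL

  derived-suffix : ∀ s (U : Fin s → List A) → Enumerates (SuffixReturn L a) U →
    ∀ z → OrderCondition (F (a ∷ φ U z)) _<A_ _<D_ →
    (∀ i j → (DerivedD _<D_ a U i j ⇔ DerivedA _<A_ a U j i)) ×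
    OrderCondition (F z) (DerivedA _<A_ a U) (DerivedD _<D_ a U)
  derived-suffix s U (U-injective , U-return , _) z ocw =
    derived-orders-reversed reversed , derived-order-condition (λ v → a ∷ φ U v) occurrence ocw
    where
    middle : Fin s → List A
    middle i = proj₁ (proj₂ (proj₂ (U-return i)))
    U≡ : ∀ i → U i ≡ middle i ++ [ a ]
    U≡ i = proj₁ (proj₂ (proj₂ (proj₂ (U-return i))))
    a∉middle : ∀ i → a ∉ middle i
    a∉middle i = proj₂ (proj₂ (proj₂ (proj₂ (U-return i))))
    ama∈L : ∀ i → L (a ∷ middle i ++ [ a ])
    ama∈L i = subst (λ u → L (a ∷ u)) (U≡ i) (proj₁ (proj₂ (U-return i)))
    middle-injective : Injective _≡_ _≡_ middle
    middle-injective eq = U-injective (trans (U≡ _) (trans (cong (_++ [ a ]) eq) (sym (U≡ _))))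
    open SuffixReturnWords irrA irrD U middle U≡ (λ i → palindromic (a∉middle i) (ama∈L i))
    open DerivedOrders _≟_ irrA irrD U middle a∉middle middle-injective DerivedD-diverge DerivedA-diverge

  derived-prefix : ∀ s (U : Fin s → List A) → Enumerates (PrefixReturn L a) U →
    ∀ z → OrderCondition (F (φ U z ++ [ a ])) _<A_ _<D_ →
    (∀ i j → (DerivedD _<D_ a U i j ⇔ DerivedA _<A_ a U j i)) ×
    OrderCondition (F z) (DerivedA _<A_ a U) (DerivedD _<D_ a U)
  derived-prefix s U (U-injective , U-return , _) z ocw =
    derived-orders-reversed reversed , derived-order-condition (λ v → φ U v ++ [ a ]) occurrence ocw
    where
    middle : Fin s → List A
    middle i = proj₁ (proj₂ (proj₂ (U-return i)))
    U≡ : ∀ i → U i ≡ a ∷ middle i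
    U≡ i = proj₁ (proj₂ (proj₂ (proj₂ (U-return i))))
    a∉middle : ∀ i → a ∉ middle i
    a∉middle i = proj₂ (proj₂ (proj₂ (proj₂ (U-return i))))
    ama∈L : ∀ i → L (a ∷ middle i ++ [ a ])
    ama∈L i = subst (λ u → L (u ++ [ a ])) (U≡ i) (proj₁ (proj₂ (U-return i)))
    middle-injective : Injective _≡_ _≡_ middle
    middle-injective eq = U-injective (trans (U≡ _) (trans (cong (a ∷_) eq) (sym (U≡ _))))
    open PrefixReturnWords irrA irrD U middle U≡ (λ i → palindromic (a∉middle i) (ama∈L i))
    open DerivedOrders _≟_ irrA irrD U middle a∉middle middle-injective DerivedD-diverge DerivedA-diverge

lemma2 : {n : ℕ} (_<A_ _<D_ : Fin n → Fin n → Set) →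
    IsStrictTotalOrder _≡_ _<A_ → IsStrictTotalOrder _≡_ _<D_ →
    (∀ x y → (x <D y ⇔ y <A x)) →
    (L : List (Fin n) → Set) → IsLanguage L → OrderCondition L _<A_ _<D_ →
    (a : Fin n) →
    -- suffix return words case
    ((s : ℕ) (U : Fin s → List (Fin n)) → Enumerates (SuffixReturn L a) U →
      (z : List (Fin s)) → OrderCondition (F (a ∷ φ U z)) _<A_ _<D_ →
      (∀ i j → (DerivedD _<D_ a U i j ⇔ DerivedA _<A_ a U j i)) ×
      OrderCondition (F z) (DerivedA _<A_ a U) (DerivedD _<D_ a U)) ×
    -- prefix return words case
    ((s : ℕ) (U : Fin s → List (Fin n)) → Enumerates (PrefixReturn L a) U →
      (z : List (Fin s)) → OrderCondition (F (φ U z ++ [ a ])) _<A_ _<D_ →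
      (∀ i j → (DerivedD _<D_ a U i j ⇔ DerivedA _<A_ a U j i)) ×
      OrderCondition (F z) (DerivedA _<A_ a U) (DerivedD _<D_ a U))
lemma2 _<A_ _<D_ stoA stoD reversed L isL ocL a =
  derived-suffix stoA stoD reversed isL ocL a , derived-prefix stoA stoD reversed isL ocL a
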